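{- Let $\omega$ be a positive integer divisible by $7$, let $\sigma$ be a request sequence in the cellular network, and fix an optimal offline feasible assignment for $\sigma$. For a cell $C_i$ let $O_i$ be the number of requests in $C_i$ accepted by this optimal assignment and $A_i$ the number of requests in $C_i$ accepted by algorithm CACO run on $\sigma$. If $O_i\le 2\omega/3$, then $A_i\ge 3O_i/7$.
   Context: The cellular network is the infinite tiling of the plane by regular hexagons (cells); two cells are neighbors if they share an edge, so each cell has 6 neighbors. Fix a proper 3-coloring of the cells with colors $R,G,B$. There are $\omega$ frequencies $\{1,\dots,\omega\}$. A request sequence is a finite sequence of cells at which call requests arrive one at a time. An online algorithm must immediately reject each request or accept it by assigning a frequency, such that two accepted calls in the same cell or in neighboring cells never have the same frequency; calls never terminate and frequencies are never changed. An optimal offline feasible assignment is a conflict-free assignment of frequencies to a maximum-size subset of the requests. Algorithm CACO: partition the frequencies into $F_R=\{1,\dots,2\omega/7\}$, $F_G=\{2\omega/7+1,\dots,4\omega/7\}$, $F_B=\{4\omega/7+1,\dots,6\omega/7\}$, $F_S=\{6\omega/7+1,\dots,\omega\}$. When a request arrives at a cell $C$ of color $c$: if some frequency of $F_c$ is not yet used in $C$, assign the smallest such frequency; otherwise, if some frequency of $F_S$ is used neither in $C$ nor in any neighbor of $C$, assign the smallest such frequency; otherwise reject. -}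

module Defs where

open import Data.Nat as ℕ using (ℕ; zero; suc; _+_; _*_; _≤_)
open import Data.Integer as ℤ using (ℤ; +_; -[1+_])
open import Data.Fin using (Fin; toℕ)
open import Data.Bool using (Bool; true; false; _∧_; _∨_; if_then_else_)
open import Data.Maybe using (Maybe; just; nothing; is-just)
open import Data.List using (List; []; _∷_; length; lookup; allFin)
open import Data.Bool.ListAction using (any)
open import Data.Product using (_×_; _,_; proj₁; proj₂)
open import Data.Product.Properties using (≡-dec)
open import Data.Sum using (_⊎_)
open import Data.List.Membership.Propositional using (_∈_)
open import Relation.Nullary using (¬_; does)
open import Relation.Binary.PropositionalEquality using (_≡_; _≢_)

-- The cellular network: hexagonal cells in axial coordinates (q , r).
-- The six neighbours of (q , r) are (q±1 , r), (q , r±1), (q+1 , r-1),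
-- (q-1 , r+1).

Cell : Set
Cell = ℤ × ℤ

_≟C_ : (c d : Cell) → Relation.Nullary.Dec (c ≡ d)
_≟C_ = ≡-dec ℤ._≟_ ℤ._≟_

directions : List Cell
directions = (+ 1 , + 0) ∷ (-[1+ 0 ] , + 0) ∷ (+ 0 , + 1) ∷ (+ 0 , -[1+ 0 ])
           ∷ (+ 1 , -[1+ 0 ]) ∷ (-[1+ 0 ] , + 1) ∷ []

diff : Cell → Cell → Cell
diff c d = (proj₁ d ℤ.- proj₁ c , proj₂ d ℤ.- proj₂ c)

Adj : Cell → Cell → Set
Adj c d = diff c d ∈ directions

Near : Cell → Cell → Set
Near c d = c ≡ d ⊎ Adj c d

open import Data.List.Membership.DecPropositional _≟C_ using (_∈?_)

near? : Cell → Cell → Bool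
near? c d = does (c ≟C d) ∨ does (diff c d ∈? directions)

-- Colours: 0 = R, 1 = G, 2 = B.
ProperColoring : (Cell → Fin 3) → Set
ProperColoring col = ∀ c d → Adj c d → col c ≢ col d

-- Offline assignments. A request sequence is a list of cells; an
-- assignment gives each request (position) either nothing (rejected)
-- or a frequency.

Assignment : List Cell → Set
Assignment σ = Fin (length σ) → Maybe ℕ

Feasible : (ω : ℕ) (σ : List Cell) → Assignment σ → Set
Feasible ω σ a =
  (∀ i f → a i ≡ just f → (1 ≤ f) × (f ≤ ω)) ×
  (∀ i j f → i ≢ j → a i ≡ just f → a j ≡ just f →
     ¬ Near (lookup σ i) (lookup σ j))

countTrue : List Bool → ℕ
countTrue [] = 0
countTrue (true ∷ bs) = suc (countTrue bs)
countTrue (false ∷ bs) = countTrue bs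

accepted : (σ : List Cell) → Assignment σ → ℕ
accepted σ a = countTrue (Data.List.map (λ i → is-just (a i)) (allFin (length σ)))

acceptedIn : (σ : List Cell) → Assignment σ → Cell → ℕ
acceptedIn σ a C =
  countTrue (Data.List.map (λ i → does (lookup σ i ≟C C) ∧ is-just (a i))
                           (allFin (length σ)))

Optimal : (ω : ℕ) (σ : List Cell) → Assignment σ → Set
Optimal ω σ a = Feasible ω σ a × (∀ b → Feasible ω σ b → accepted σ b ≤ accepted σ a)

-- Algorithm CACO with ω = 7 * k.
-- F_c = {2kc+1 , … , 2kc+2k} for colour c ∈ {0,1,2}, F_S = {6k+1 , … , 7k}.

firstFree : (ℕ → Bool) → ℕ → ℕ → Maybe ℕ
firstFree used lo zero = nothing
firstFree used lo (suc n) = if used lo then firstFree used (suc lo) n else just lo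

-- state: the accepted calls so far, as (cell , frequency) pairs
usedIn : List (Cell × ℕ) → Cell → ℕ → Bool
usedIn st C f = any (λ p → does (proj₁ p ≟C C) ∧ does (proj₂ p ℕ.≟ f)) st

usedNear : List (Cell × ℕ) → Cell → ℕ → Bool
usedNear st C f = any (λ p → near? (proj₁ p) C ∧ does (proj₂ p ℕ.≟ f)) st

cacoStep : (k : ℕ) → (Cell → Fin 3) → List (Cell × ℕ) → Cell → Maybe ℕ
cacoStep k col st C with firstFree (usedIn st C) (toℕ (col C) * (2 * k) + 1) (2 * k)
... | just f = just f
... | nothing = firstFree (usedNear st C) (6 * k + 1) k

cacoRun : (k : ℕ) → (Cell → Fin 3) → List (Cell × ℕ) → List Cell → List (Cell × Maybe ℕ)
cacoRun k col st [] = []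
cacoRun k col st (C ∷ σ) with cacoStep k col st C
... | just f = (C , just f) ∷ cacoRun k col ((C , f) ∷ st) σ
... | nothing = (C , nothing) ∷ cacoRun k col st σ

caco : (k : ℕ) → (Cell → Fin 3) → List Cell → List (Cell × Maybe ℕ)
caco k col σ = cacoRun k col [] σ

cacoAcceptedIn : (k : ℕ) → (Cell → Fin 3) → List Cell → Cell → ℕ
cacoAcceptedIn k col σ C =
  countTrue (Data.List.map (λ p → does (proj₁ p ≟C C) ∧ is-just (proj₂ p)) (caco k col σ))

module Submission where

open import Defs
open import Data.Nat using (ℕ; _*_; _≤_)
open import Data.Fin using (Fin)
open import Data.List using (List)

-- Let C have colour c and let O and A be the numbers of requests in C
-- accepted by the optimal assignment and by CACO.  CACO rejects a
-- request at C only when every one of the 2k frequencies of its own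
-- pool F_c is already in use in C; each such frequency is carried by a
-- distinct call accepted in C, so from then on A ≥ 2k.  Hence either
-- CACO accepts every request made at C, and then O ≤ (number of
-- requests at C) ≤ A, or A ≥ 2k, and then 3O ≤ 2ω = 14k ≤ 7A.

open import Data.Nat as ℕ using (zero; suc; _+_; _<_; z≤n; s≤s)
open import Data.Nat.Properties
open import Data.Fin using (toℕ)
open import Data.Bool using (Bool; true; false; _∧_; _∨_)
open import Data.Maybe using (just; nothing; is-just)
open import Data.List using ([]; _∷_; map; allFin; length; lookup)
open import Data.List.Properties using (map-∘; map-tabulate; tabulate-lookup)
open import Data.Product using (_×_; _,_; proj₁; proj₂)
open import Data.Sum using (_⊎_; inj₁; inj₂)
open import Relation.Nullary using (does; yes; no; contradiction)
open import Relation.Binary.PropositionalEquality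
open import Algebra.Properties.CommutativeSemigroup +-commutativeSemigroup
  using (interchange)

bit : Bool → ℕ
bit true = 1
bit false = 0

countTrue-mono : ∀ {A : Set} (p q : A → Bool) → (∀ x → p x ≡ true → q x ≡ true) →
  (xs : List A) → countTrue (map p xs) ≤ countTrue (map q xs)
countTrue-mono p q p⇒q [] = z≤n
countTrue-mono p q p⇒q (x ∷ xs) with p x in px | q x in qx
... | true  | true  = s≤s (countTrue-mono p q p⇒q xs)
... | true  | false = contradiction (trans (sym (p⇒q x px)) qx) λ ()
... | false | true  = m≤n⇒m≤1+n (countTrue-mono p q p⇒q xs)
... | false | false = countTrue-mono p q p⇒q xs

requestsIn : List Cell → Cell → ℕ
requestsIn σ C = countTrue (map (λ D → does (D ≟C C)) σ)

acceptedIn≤requestsIn : ∀ σ (a : Assignment σ) C → acceptedIn σ a C ≤ requestsIn σ C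
acceptedIn≤requestsIn σ a C = begin
  acceptedIn σ a C
    ≤⟨ countTrue-mono (λ i → atC i ∧ is-just (a i)) atC (λ i → ∧-true) (allFin (length σ)) ⟩
  countTrue (map atC (allFin (length σ)))
    ≡⟨ cong countTrue (map-∘ (allFin (length σ))) ⟩
  countTrue (map isC (map (lookup σ) (allFin (length σ))))
    ≡⟨ cong (λ ds → countTrue (map isC ds))
            (trans (map-tabulate (λ i → i) (lookup σ)) (tabulate-lookup σ)) ⟩
  requestsIn σ C ∎
  where
  open ≤-Reasoning
  isC : Cell → Bool
  isC D = does (D ≟C C)
  atC : Fin (length σ) → Bool
  atC i = isC (lookup σ i)
  ∧-true : ∀ {b c} → b ∧ c ≡ true → b ≡ true
  ∧-true {true} _ = refl

countRange : (ℕ → Bool) → ℕ → ℕ → ℕ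
countRange u lo zero = 0
countRange u lo (suc n) = bit (u lo) + countRange u (suc lo) n

firstFree-nothing : ∀ u lo n → firstFree u lo n ≡ nothing → countRange u lo n ≡ n
firstFree-nothing u lo zero _ = refl
firstFree-nothing u lo (suc n) none with u lo
... | true = cong suc (firstFree-nothing u (suc lo) n none)

countRange-∨ : ∀ u v lo n →
  countRange (λ f → u f ∨ v f) lo n ≤ countRange u lo n + countRange v lo n
countRange-∨ u v lo zero = z≤n
countRange-∨ u v lo (suc n) = begin
  bit (u lo ∨ v lo) + countRange (λ f → u f ∨ v f) (suc lo) n
    ≤⟨ +-mono-≤ (bit-∨ (u lo) (v lo)) (countRange-∨ u v (suc lo) n) ⟩
  (bit (u lo) + bit (v lo)) + (countRange u (suc lo) n + countRange v (suc lo) n)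
    ≡⟨ interchange (bit (u lo)) (bit (v lo)) _ _ ⟩
  (bit (u lo) + countRange u (suc lo) n) + (bit (v lo) + countRange v (suc lo) n) ∎
  where
  open ≤-Reasoning
  bit-∨ : ∀ a b → bit (a ∨ b) ≤ bit a + bit b
  bit-∨ true b = s≤s z≤n
  bit-∨ false b = ≤-refl

countRange-below : ∀ x lo n → x < lo → countRange (λ f → does (x ℕ.≟ f)) lo n ≡ 0
countRange-below x lo zero _ = refl
countRange-below x lo (suc n) x<lo with x ℕ.≡ᵇ lo | ≡ᵇ⇒≡ x lo
... | true  | x≡lo = contradiction x<lo (<-irrefl (x≡lo _))
... | false | _    = countRange-below x (suc lo) n (m<n⇒m<1+n x<lo)

countRange-single : ∀ x lo n → countRange (λ f → does (x ℕ.≟ f)) lo n ≤ 1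
countRange-single x lo zero = z≤n
countRange-single x lo (suc n) with x ℕ.≡ᵇ lo | ≡ᵇ⇒≡ x lo
... | true  | x≡lo = ≤-reflexive (cong suc
                       (countRange-below x (suc lo) n (≤-reflexive (cong suc (x≡lo _)))))
... | false | _    = countRange-single x (suc lo) n

callsIn : List (Cell × ℕ) → Cell → ℕ
callsIn st C = countTrue (map (λ p → does (proj₁ p ≟C C)) st)

-- Each frequency used in C is carried by its own call in C, so a range
-- contains at most callsIn st C frequencies used in C.
countRange-usedIn : ∀ st C lo n → countRange (usedIn st C) lo n ≤ callsIn st C
countRange-usedIn [] C lo zero = z≤n
countRange-usedIn [] C lo (suc n) = countRange-usedIn [] C (suc lo) n
countRange-usedIn ((D , x) ∷ st) C lo n with D ≟C C
... | no _ = countRange-usedIn st C lo n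
... | yes _ = ≤-trans (countRange-∨ (λ f → does (x ℕ.≟ f)) (usedIn st C) lo n)
                      (+-mono-≤ (countRange-single x lo n) (countRange-usedIn st C lo n))

-- CACO rejects a request at C only if its own pool F_c is fully used
-- in C, and then C already holds at least 2k calls.  (If the own pool
-- had a free frequency, cacoStep would return it, contradicting the
-- rejection; so only the case of a full own pool remains.)
rejection⇒saturated : ∀ k col st C → cacoStep k col st C ≡ nothing → 2 * k ≤ callsIn st C
rejection⇒saturated k col st C rejected
  with firstFree (usedIn st C) (toℕ (col C) * (2 * k) + 1) (2 * k) in ownPoolFull
... | nothing = begin
  2 * k                                   ≡⟨ firstFree-nothing _ _ _ ownPoolFull ⟨
  countRange (usedIn st C) lo (2 * k)    ≤⟨ countRange-usedIn st C lo (2 * k) ⟩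
  callsIn st C                            ∎
  where
  open ≤-Reasoning
  lo : ℕ
  lo = toℕ (col C) * (2 * k) + 1

acceptedFrom : ℕ → (Cell → Fin 3) → List (Cell × ℕ) → List Cell → Cell → ℕ
acceptedFrom k col st σ C =
  countTrue (map (λ p → does (proj₁ p ≟C C) ∧ is-just (proj₂ p)) (cacoRun k col st σ))

allAccepted-or-saturated : ∀ k col st σ C →
  requestsIn σ C ≤ acceptedFrom k col st σ C ⊎ 2 * k ≤ callsIn st C + acceptedFrom k col st σ C
allAccepted-or-saturated k col st [] C = inj₁ z≤n
allAccepted-or-saturated k col st (D ∷ σ) C with cacoStep k col st D in step
... | just f with D ≟C C | allAccepted-or-saturated k col ((D , f) ∷ st) σ C
...   | yes refl | inj₁ allAccepted = inj₁ (s≤s allAccepted)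
...   | yes refl | inj₂ saturated   = inj₂ (≤-trans saturated (≤-reflexive (sym (+-suc _ _))))
...   | no _     | invariant        = invariant
allAccepted-or-saturated k col st (D ∷ σ) C | nothing with D ≟C C
...   | yes refl = inj₂ (m≤n⇒m≤n+o _ (rejection⇒saturated k col st D step))
...   | no _     = allAccepted-or-saturated k col st σ C

lemma1 : (k : ℕ) → 1 ≤ k →
    (col : Cell → Fin 3) → ProperColoring col →
    (σ : List Cell) → (opt : Assignment σ) → Optimal (7 * k) σ opt →
    (C : Cell) →
    3 * acceptedIn σ opt C ≤ 2 * (7 * k) →
    3 * acceptedIn σ opt C ≤ 7 * cacoAcceptedIn k col σ C
lemma1 k _ col _ σ opt _ C lightLoad with allAccepted-or-saturated k col [] σ C
... | inj₁ allAccepted = begin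
  3 * acceptedIn σ opt C ≤⟨ *-monoʳ-≤ 3 (acceptedIn≤requestsIn σ opt C) ⟩
  3 * requestsIn σ C     ≤⟨ *-monoʳ-≤ 3 allAccepted ⟩
  3 * A                  ≤⟨ *-monoˡ-≤ A {3} {7} (s≤s (s≤s (s≤s z≤n))) ⟩
  7 * A                  ∎
  where
  open ≤-Reasoning
  A : ℕ
  A = cacoAcceptedIn k col σ C
... | inj₂ saturated = begin
  3 * acceptedIn σ opt C ≤⟨ lightLoad ⟩
  2 * (7 * k)            ≡⟨ *-assoc 2 7 k ⟨
  14 * k                 ≡⟨ *-assoc 7 2 k ⟩
  7 * (2 * k)            ≤⟨ *-monoʳ-≤ 7 saturated ⟩
  7 * cacoAcceptedIn k col σ C ∎
  where open ≤-Reasoning
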